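{- Let $G$ be an $\{\mathrm{ISK}_4, \text{diamond}, \text{bowtie}, \text{prism}, K_{3,3}\}$-free graph without clique cutsets, and let $s$ be the center of a proper wheel in $G$. Let $K$ be a connected component of $G-N[s]$ and let $N\subseteq N(s)$ be the set of neighbors of $s$ that have a neighbor in $V(K)$. If $G[V(K)\cup N\cup\{s\}]$ is series-parallel, then $N$ is an independent set in $G$.
   Context: "$H$-free" means no induced subgraph isomorphic to $H$; $\mathrm{ISK}_4$-free means no induced subdivision of $K_4$. Diamond: $K_4$ minus an edge. Bowtie: two triangles sharing one vertex. Prism: three vertex-disjoint paths $a_i\ldots b_i$ ($i=1,2,3$) of length $\ge1$ with $a_1a_2a_3$ and $b_1b_2b_3$ triangles and no other edges between the paths. A cutset is a nonempty vertex set whose removal increases the number of connected components; a clique cutset is a cutset that is a clique. A graph is series-parallel if it contains no subdivision of $K_4$ as a (not necessarily induced) subgraph. A hole is an induced cycle of length at least four. A wheel $W=(C,x)$ (center $x$) consists of a hole $C$ and a vertex $x\notin V(C)$ with at least three neighbors in $V(C)$; spokes are the neighbors of $x$ in $C$; a sector is a subpath of $C$ whose ends are spokes and whose interior contains no spoke. A vertex $v$ is proper for $W$ if $v\in V(C)\cup\{x\}$, or all neighbors of $v$ in $V(C)$ lie in one sector and, if $v$ has more than two neighbors in $V(C)$, then $vx\in E(G)$. $W$ is proper in $G$ if every vertex of $G$ is proper for $W$. -}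

module Defs where

open import Data.Nat using (ℕ; zero; suc; _+_; _≤_; _<_; _≡ᵇ_)
open import Data.Nat.DivMod using (_mod_)
open import Data.Fin using (Fin; toℕ; inject₁; fromℕ) renaming (zero to fz; suc to fs)
open import Data.Bool using (Bool; true; false; _∨_; _∧_)
open import Data.List using (List; []; _∷_)
open import Data.Bool.ListAction using (any)
open import Data.Product using (Σ; ∃; ∃-syntax; _×_; _,_; proj₁; proj₂)
open import Data.Sum using (_⊎_)
open import Data.Unit using (⊤)
open import Relation.Nullary using (¬_)
open import Relation.Binary.PropositionalEquality using (_≡_; _≢_)


data K4Pair : Set where
  p01 p02 p03 p12 p13 p23 : K4Pair

pfst psnd : K4Pair → Fin 4
pfst p01 = fz
pfst p02 = fz
pfst p03 = fz
pfst p12 = fs fz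
pfst p13 = fs fz
pfst p23 = fs (fs fz)
psnd p01 = fs fz
psnd p02 = fs (fs fz)
psnd p03 = fs (fs (fs fz))
psnd p12 = fs (fs fz)
psnd p13 = fs (fs (fs fz))
psnd p23 = fs (fs (fs fz))

fromEdges : {m : ℕ} → List (ℕ × ℕ) → Fin m → Fin m → Bool
fromEdges es i j = any (λ e → ((proj₁ e ≡ᵇ toℕ i) ∧ (proj₂ e ≡ᵇ toℕ j))
                            ∨ ((proj₁ e ≡ᵇ toℕ j) ∧ (proj₂ e ≡ᵇ toℕ i))) es

-- diamond = K4 minus the edge 23
diamond : Fin 4 → Fin 4 → Bool
diamond = fromEdges ((0 , 1) ∷ (0 , 2) ∷ (0 , 3) ∷ (1 , 2) ∷ (1 , 3) ∷ [])

-- bowtie = triangles 012 and 034 sharing vertex 0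
bowtie : Fin 5 → Fin 5 → Bool
bowtie = fromEdges ((0 , 1) ∷ (0 , 2) ∷ (1 , 2) ∷ (0 , 3) ∷ (0 , 4) ∷ (3 , 4) ∷ [])

K33 : Fin 6 → Fin 6 → Bool
K33 = fromEdges ((0 , 3) ∷ (0 , 4) ∷ (0 , 5) ∷ (1 , 3) ∷ (1 , 4) ∷ (1 , 5)
                 ∷ (2 , 3) ∷ (2 , 4) ∷ (2 , 5) ∷ [])

record Graph : Set where
  field
    n      : ℕ
    adj    : Fin n → Fin n → Bool
    sym    : ∀ u v → adj u v ≡ adj v u
    irrefl : ∀ v → adj v v ≡ false

module _ (G : Graph) where
  open Graph G

  V : Set
  V = Fin n

  E : V → V → Set
  E u v = adj u v ≡ true

  ContainsInduced : (m : ℕ) → (Fin m → Fin m → Bool) → Set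
  ContainsInduced m h =
    Σ (Fin m → V) λ f →
      (∀ i j → f i ≡ f j → i ≡ j) × (∀ i j → h i j ≡ adj (f i) (f j))

  record Path : Set where
    field
      len   : ℕ
      vtx   : Fin (suc len) → V
      inj   : ∀ i j → vtx i ≡ vtx j → i ≡ j
      edges : ∀ (t : Fin len) → E (vtx (inject₁ t)) (vtx (fs t))

    start : V
    start = vtx fz

    end : V
    end = vtx (fromℕ len)

    OnPath : V → Set
    OnPath v = ∃[ t ] vtx t ≡ v

    Interior : Fin (suc len) → Set
    Interior t = (0 < toℕ t) × (toℕ t < len)

    PathEdge : V → V → Set
    PathEdge u v = ∃[ t ] ((vtx (inject₁ t) ≡ u × vtx (fs t) ≡ v)
                          ⊎ (vtx (inject₁ t) ≡ v × vtx (fs t) ≡ u))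

  -- Subdivisions of K4 contained in G (as a not necessarily induced subgraph)

  record K4Sub : Set where
    field
      br        : Fin 4 → V
      br-inj    : ∀ i j → br i ≡ br j → i ≡ j
      path      : K4Pair → Path
      starts    : ∀ p → Path.start (path p) ≡ br (pfst p)
      ends      : ∀ p → Path.end (path p) ≡ br (psnd p)
      int-nobr  : ∀ p t → Path.Interior (path p) t → ∀ i → Path.vtx (path p) t ≢ br i
      int-disj  : ∀ p q → p ≢ q → ∀ t t' → Path.Interior (path p) t →
                  Path.vtx (path p) t ≢ Path.vtx (path q) t'

    Vert : V → Set
    Vert v = ∃[ p ] Path.OnPath (path p) v

    Induced : Set
    Induced = ∀ u v → Vert u → Vert v → E u v → ∃[ p ] Path.PathEdge (path p) u v

  HasISK4 : Set
  HasISK4 = Σ K4Sub K4Sub.Induced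

  -- G[X] is series-parallel: no subdivision of K4 as a subgraph of G[X]
  SeriesParallel : (V → Set) → Set
  SeriesParallel X = ¬ (Σ K4Sub λ S → ∀ v → K4Sub.Vert S v → X v)

  record Prism : Set where
    field
      path    : Fin 3 → Path
      nontriv : ∀ i → 1 ≤ Path.len (path i)
      disj    : ∀ i j t t' → Path.vtx (path i) t ≡ Path.vtx (path j) t' → i ≡ j
      triA    : ∀ i j → i ≢ j → E (Path.start (path i)) (Path.start (path j))
      triB    : ∀ i j → i ≢ j → E (Path.end (path i)) (Path.end (path j))

    Vert : V → Set
    Vert v = ∃[ i ] Path.OnPath (path i) v

    Induced : Set
    Induced = ∀ u v → Vert u → Vert v → E u v →
              (∃[ i ] Path.PathEdge (path i) u v)
              ⊎ (∃[ i ] ∃[ j ] (u ≡ Path.start (path i) × v ≡ Path.start (path j)))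
              ⊎ (∃[ i ] ∃[ j ] (u ≡ Path.end (path i) × v ≡ Path.end (path j)))

  HasPrism : Set
  HasPrism = Σ Prism Prism.Induced

  data Walk (A : V → Set) : V → V → Set where
    here : ∀ {u} → A u → Walk A u u
    step : ∀ {u w v} → A u → E u w → Walk A w v → Walk A u v

  NComp : (V → Set) → ℕ → Set
  NComp A k =
    Σ (Fin k → V) λ r →
      (∀ i → A (r i)) ×
      (∀ i j → i ≢ j → ¬ Walk A (r i) (r j)) ×
      (∀ v → A v → ∃[ i ] Walk A v (r i))

  IsComponent : (V → Set) → (V → Set) → Set
  IsComponent A K =
    (∃[ v ] K v) ×
    (∀ v → K v → A v) ×
    (∀ u v → K u → K v → Walk A u v) ×
    (∀ u v → K u → Walk A u v → K v)

  Clique : (V → Set) → Set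
  Clique S = ∀ u v → S u → S v → u ≢ v → E u v

  Cutset : (V → Set) → Set
  Cutset S = (∃[ v ] S v) ×
             (∃[ k ] ∃[ k' ] (NComp (λ _ → ⊤) k × NComp (λ v → ¬ S v) k' × k < k'))

  NoCliqueCutset : Set₁
  NoCliqueCutset = ∀ (S : V → Set) → Clique S → ¬ Cutset S

  CycAdj : (k : ℕ) → Fin k → Fin k → Set
  CycAdj k i j = (suc (toℕ i) ≡ toℕ j) ⊎ (suc (toℕ j) ≡ toℕ i)
               ⊎ (suc (toℕ i) ≡ k × toℕ j ≡ 0) ⊎ (suc (toℕ j) ≡ k × toℕ i ≡ 0)

  record Hole : Set where
    field
      m    : ℕ
      c    : Fin (4 + m) → V
      inj  : ∀ i j → c i ≡ c j → i ≡ j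
      adjC : ∀ i j → E (c i) (c j) → CycAdj (4 + m) i j
      cycC : ∀ i j → CycAdj (4 + m) i j → E (c i) (c j)

    cyc : ℕ → V
    cyc t = c (t mod (4 + m))

    InC : V → Set
    InC v = ∃[ i ] c i ≡ v

    ThreeNbrs : V → Set
    ThreeNbrs v = ∃[ i ] ∃[ j ] ∃[ l ]
      (i ≢ j × i ≢ l × j ≢ l × E v (c i) × E v (c j) × E v (c l))

  module _ (C : Hole) (x : V) where
    open Hole C

    IsWheel : Set
    IsWheel = ¬ InC x × ThreeNbrs x

    Spoke : V → Set
    Spoke v = E x v

    -- all neighbours of v in V(C) lie in one sector: the subpath
    -- cyc i, cyc (i+1), ..., cyc (i+t) whose ends are spokes and whose
    -- interior contains no spoke
    NbrsInOneSector : V → Set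
    NbrsInOneSector v = ∃[ i ] ∃[ t ]
      (1 ≤ t × Spoke (cyc i) × Spoke (cyc (i + t)) ×
       (∀ u → 0 < u → u < t → ¬ Spoke (cyc (i + u))) ×
       (∀ j → E v (c j) → ∃[ u ] (u ≤ t × c j ≡ cyc (i + u))))

    ProperVertex : V → Set
    ProperVertex v = InC v ⊎ v ≡ x ⊎ (NbrsInOneSector v × (ThreeNbrs v → E v x))

    IsProperWheel : Set
    IsProperWheel = IsWheel × (∀ v → ProperVertex v)

  ProperWheelCenter : V → Set
  ProperWheelCenter s = ∃[ C ] IsProperWheel C s

-- Suppose u, v ∈ N are adjacent. If N = {u, v}, then {u, v} is a clique separating s from K,
-- which is excluded. Otherwise there is a third z ∈ N. Take a path P in K between neighbours
-- of u and v, and a path Q in K from a neighbour of z to the first vertex t where it meets P.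
-- Then s, u, t, v are the branch vertices of a subdivision of K₄ inside G[V(K) ∪ N ∪ {s}]:
-- the edges su, sv, uv, the path s z Q, and the two halves of P prolonged to u and to v.
-- So G[V(K) ∪ N ∪ {s}] is not series-parallel.

module Submission where

open import Defs
open import Data.Nat as ℕ using (ℕ; zero; suc; s≤s)
import Data.Nat.Properties as ℕ
open import Data.Fin using (Fin; toℕ; inject₁; fromℕ) renaming (zero to fz; suc to fs)
import Data.Fin.Properties as Fin
open import Data.Bool using (true)
import Data.Bool.Properties as Bool
open import Data.Product using (Σ; ∃; ∃-syntax; _×_; _,_; proj₁; proj₂)
open import Data.Sum using (_⊎_; inj₁; inj₂; [_,_]; map; map₁)
open import Data.Unit using (⊤; tt)
open import Data.Empty using (⊥; ⊥-elim)
open import Relation.Nullary using (¬_; Dec; yes; no)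
open import Relation.Nullary.Decidable using (_×-dec_; _⊎-dec_; ¬?; _→-dec_)
open import Data.List as List using (List; []; _∷_; filter; lookup; allFin)
import Data.List.Relation.Unary.Any as Any
open import Data.List.Relation.Unary.Any.Properties using (lookup-index)
import Data.List.Relation.Unary.All as All
open import Data.List.Relation.Unary.AllPairs using ([]; _∷_)
open import Data.List.Relation.Unary.Unique.Propositional using (Unique)
open import Data.List.Relation.Unary.Unique.Propositional.Properties using (filter⁺; allFin⁺)
open import Data.List.Membership.Propositional.Properties using (∈-filter⁺; ∈-filter⁻; ∈-lookup; ∈-allFin)
open import Relation.Binary.PropositionalEquality using (_≡_; _≢_; refl; sym; trans; cong; subst)
open import Function using (_∘_)

surjective-with-collision⇒< : ∀ {k k′} (f : Fin k′ → Fin k) → (∀ j → ∃[ i ] f i ≡ j) →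
                              ∀ i₁ i₂ → i₁ ≢ i₂ → f i₁ ≡ f i₂ → k ℕ.< k′
surjective-with-collision⇒< {k} {k′} f surj i₁ i₂ i₁≢i₂ fi₁≡fi₂ = Fin.injective⇒≤ (λ {x} {y} → h-injective x y)
  where
  g : Fin k → Fin k′
  g j = proj₁ (surj j)

  g-section : ∀ j → f (g j) ≡ j
  g-section j = proj₂ (surj j)

  missed-by-g : ∀ e → f e ≡ f i₁ → e ≢ g (f i₁) → ∀ j → e ≢ g j
  missed-by-g e fe≡fi₁ e≢g j refl = e≢g (cong g (trans (sym (g-section j)) fe≡fi₁))

  missed : ∃[ e ] ∀ j → e ≢ g j
  missed with i₁ Fin.≟ g (f i₁)
  ... | yes i₁≡g = i₂ , missed-by-g i₂ (sym fi₁≡fi₂) (λ i₂≡g → i₁≢i₂ (trans i₁≡g (sym i₂≡g)))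
  ... | no i₁≢g = i₁ , missed-by-g i₁ refl i₁≢g

  h : Fin (suc k) → Fin k′
  h fz = proj₁ missed
  h (fs j) = g j

  h-injective : ∀ x y → h x ≡ h y → x ≡ y
  h-injective fz fz _ = refl
  h-injective fz (fs j) eq = ⊥-elim (proj₂ missed j eq)
  h-injective (fs j) fz eq = ⊥-elim (proj₂ missed j (sym eq))
  h-injective (fs i) (fs j) eq = cong fs (trans (sym (g-section i)) (trans (cong f eq) (g-section j)))

module Walks (G : Graph) where
  open Graph G using (n; adj; irrefl) renaming (sym to adj-sym)

  E-sym : ∀ {x y} → E G x y → E G y x
  E-sym {x} {y} e = trans (adj-sym y x) e

  E-irrefl : ∀ {x} → ¬ E G x x
  E-irrefl {x} e with trans (sym (irrefl x)) e
  ... | ()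

  E⇒≢ : ∀ {x y} → E G x y → x ≢ y
  E⇒≢ e refl = E-irrefl e

  E? : ∀ x y → Dec (E G x y)
  E? x y = adj x y Bool.≟ true

  module _ {A : V G → Set} where

    source∈ : ∀ {a b} → Walk G A a b → A a
    source∈ (here x) = x
    source∈ (step x _ _) = x

    target∈ : ∀ {a b} → Walk G A a b → A b
    target∈ (here x) = x
    target∈ (step _ _ w) = target∈ w

    _++ʷ_ : ∀ {a b c} → Walk G A a b → Walk G A b c → Walk G A a c
    here _ ++ʷ W′ = W′
    step x e W ++ʷ W′ = step x e (W ++ʷ W′)

    snoc : ∀ {a b c} → Walk G A a b → A c → E G b c → Walk G A a c
    snoc (here x) y e = step x e (here y)
    snoc (step x e W) y e′ = step x e (snoc W y e′)

    reverse : ∀ {a b} → Walk G A a b → Walk G A b a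
    reverse (here x) = here x
    reverse (step x e W) = snoc (reverse W) x (E-sym e)

    length : ∀ {a b} → Walk G A a b → ℕ
    length (here _) = 0
    length (step _ _ W) = suc (length W)

    vertexAt : ∀ {a b} (W : Walk G A a b) → Fin (suc (length W)) → V G
    vertexAt {a} (here _) _ = a
    vertexAt {a} (step _ _ W) fz = a
    vertexAt (step _ _ W) (fs i) = vertexAt W i

    vertexAt-first : ∀ {a b} (W : Walk G A a b) → vertexAt W fz ≡ a
    vertexAt-first (here _) = refl
    vertexAt-first (step _ _ _) = refl

    vertexAt-last : ∀ {a b} (W : Walk G A a b) → vertexAt W (fromℕ (length W)) ≡ b
    vertexAt-last (here _) = refl
    vertexAt-last (step _ _ W) = vertexAt-last W

    vertexAt-edge : ∀ {a b} (W : Walk G A a b) (i : Fin (length W)) →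
                    E G (vertexAt W (inject₁ i)) (vertexAt W (fs i))
    vertexAt-edge (step _ e W) fz = subst (E G _) (sym (vertexAt-first W)) e
    vertexAt-edge (step _ _ W) (fs i) = vertexAt-edge W i

    infix 4 _∈ʷ_
    _∈ʷ_ : ∀ {a b} → V G → Walk G A a b → Set
    x ∈ʷ W = ∃[ i ] vertexAt W i ≡ x

    _∈ʷ?_ : ∀ {a b} x (W : Walk G A a b) → Dec (x ∈ʷ W)
    x ∈ʷ? W = Fin.any? (λ i → vertexAt W i Fin.≟ x)

    _⊆ʷ_ : ∀ {a b c d} → Walk G A a b → Walk G A c d → Set
    W ⊆ʷ W′ = ∀ {x} → x ∈ʷ W → x ∈ʷ W′

    source∈ʷ : ∀ {a b} (W : Walk G A a b) → a ∈ʷ W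
    source∈ʷ W = fz , vertexAt-first W

    ∈-step⁻ : ∀ {a w b x} {ax : A a} {e : E G a w} {W : Walk G A w b} →
              x ∈ʷ step ax e W → x ≡ a ⊎ x ∈ʷ W
    ∈-step⁻ (fz , refl) = inj₁ refl
    ∈-step⁻ (fs i , p) = inj₂ (i , p)

    ∈-step⁺ : ∀ {a w b x} {ax : A a} {e : E G a w} {W : Walk G A w b} →
              x ∈ʷ W → x ∈ʷ step ax e W
    ∈-step⁺ (i , p) = fs i , p

    ∈-snoc⁻ : ∀ {a b c x} (W : Walk G A a b) {ac : A c} {e : E G b c} →
              x ∈ʷ snoc W ac e → x ∈ʷ W ⊎ x ≡ c
    ∈-snoc⁻ (here _) (fz , refl) = inj₁ (fz , refl)
    ∈-snoc⁻ (here _) (fs _ , refl) = inj₂ refl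
    ∈-snoc⁻ (step _ _ W) (fz , refl) = inj₁ (fz , refl)
    ∈-snoc⁻ (step _ _ W) (fs i , p) = map₁ ∈-step⁺ (∈-snoc⁻ W (i , p))

    ∈ʷ⇒∈ : ∀ {a b x} (W : Walk G A a b) → x ∈ʷ W → A x
    ∈ʷ⇒∈ (here ax) (_ , refl) = ax
    ∈ʷ⇒∈ (step ax _ _) (fz , refl) = ax
    ∈ʷ⇒∈ (step _ _ W) (fs i , p) = ∈ʷ⇒∈ W (i , p)

    IsPath : ∀ {a b} → Walk G A a b → Set
    IsPath (here _) = ⊤
    IsPath {a} (step _ _ W) = ¬ a ∈ʷ W × IsPath W

    isPath⇒injective : ∀ {a b} (W : Walk G A a b) → IsPath W →
                       ∀ i j → vertexAt W i ≡ vertexAt W j → i ≡ j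
    isPath⇒injective (here _) _ fz fz _ = refl
    isPath⇒injective (step _ _ W) _ fz fz _ = refl
    isPath⇒injective (step _ _ W) (a∉W , _) fz (fs j) p = ⊥-elim (a∉W (j , sym p))
    isPath⇒injective (step _ _ W) (a∉W , _) (fs i) fz p = ⊥-elim (a∉W (i , p))
    isPath⇒injective (step _ _ W) (_ , P) (fs i) (fs j) p = cong fs (isPath⇒injective W P i j p)

    path-length< : ∀ {a b} (W : Walk G A a b) → IsPath W → length W ℕ.< n
    path-length< W P = Fin.injective⇒≤ (λ {i} {j} → isPath⇒injective W P i j)

    snoc-isPath : ∀ {a b c} (W : Walk G A a b) {ac : A c} {e : E G b c} →
                  IsPath W → ¬ c ∈ʷ W → IsPath (snoc W ac e)
    snoc-isPath (here _) _ c∉W = (λ { (fz , refl) → c∉W (fz , refl) }) , tt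
    snoc-isPath (step _ _ W) (a∉W , P) c∉W =
      [ a∉W , (λ { refl → c∉W (fz , refl) }) ] ∘ ∈-snoc⁻ W ,
      snoc-isPath W P (c∉W ∘ ∈-step⁺)

    suffixFrom : ∀ {a b x} (W : Walk G A a b) → x ∈ʷ W → IsPath W →
                 Σ (Walk G A x b) λ W′ → IsPath W′ × W′ ⊆ʷ W
    suffixFrom (here ax) (fz , refl) _ = here ax , tt , λ m → m
    suffixFrom (step ax e W) (fz , refl) P = step ax e W , P , λ m → m
    suffixFrom (step ax e W) (fs i , p) (_ , P) with suffixFrom W (i , p) P
    ... | W′ , P′ , W′⊆W = W′ , P′ , ∈-step⁺ ∘ W′⊆W

    walk⇒path : ∀ {a b} (W : Walk G A a b) → Σ (Walk G A a b) λ W′ → IsPath W′ × W′ ⊆ʷ W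
    walk⇒path (here ax) = here ax , tt , λ m → m
    walk⇒path {a} (step ax e W) with walk⇒path W
    ... | W′ , P′ , W′⊆W with a ∈ʷ? W′
    ...   | no a∉W′ = step ax e W′ , (a∉W′ , P′) , [ (λ { refl → fz , refl }) , ∈-step⁺ ∘ W′⊆W ] ∘ ∈-step⁻
    ...   | yes a∈W′ with suffixFrom W′ a∈W′ P′
    ...     | W″ , P″ , W″⊆W′ = W″ , P″ , ∈-step⁺ ∘ W′⊆W ∘ W″⊆W′

    splitAt : ∀ {a b t} (W : Walk G A a b) → IsPath W → t ∈ʷ W →
              Σ (Walk G A a t) λ W₁ → Σ (Walk G A t b) λ W₂ →
              IsPath W₁ × IsPath W₂ × W₁ ⊆ʷ W × W₂ ⊆ʷ W × (∀ {x} → x ∈ʷ W₁ → x ∈ʷ W₂ → x ≡ t)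
    splitAt (here ax) _ (fz , refl) = here ax , here ax , tt , tt , (λ m → m) , (λ m → m) , λ { (fz , refl) _ → refl }
    splitAt (step ax e W) P (fz , refl) =
      here ax , step ax e W , tt , P , (λ { (fz , refl) → fz , refl }) , (λ m → m) , λ { (fz , refl) _ → refl }
    splitAt (step ax e W) (a∉W , P) (fs i , p) with splitAt W P (i , p)
    ... | W₁ , W₂ , P₁ , P₂ , W₁⊆W , W₂⊆W , W₁∩W₂ =
      step ax e W₁ , W₂ , (a∉W ∘ W₁⊆W , P₁) , P₂ ,
      [ (λ { refl → fz , refl }) , ∈-step⁺ ∘ W₁⊆W ] ∘ ∈-step⁻ ,
      ∈-step⁺ ∘ W₂⊆W ,
      λ m₁ m₂ → [ (λ { refl → ⊥-elim (a∉W (W₂⊆W m₂)) }) , (λ m → W₁∩W₂ m m₂) ] (∈-step⁻ m₁)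

    prefixToFirst : (B : V G → Set) → (∀ x → Dec (B x)) → ∀ {c y} → Walk G A c y → B y →
                    ∃[ t ] (B t × Σ (Walk G A c t) λ W → ∀ {x} → x ∈ʷ W → B x → x ≡ t)
    prefixToFirst B B? {c} (here ac) By = c , By , here ac , λ { (fz , refl) _ → refl }
    prefixToFirst B B? {c} (step ac e W) By with B? c
    ... | yes Bc = c , Bc , here ac , λ { (fz , refl) _ → refl }
    ... | no ¬Bc with prefixToFirst B B? W By
    ...   | t , Bt , W′ , first = t , Bt , step ac e W′ ,
            λ m Bx → [ (λ { refl → ⊥-elim (¬Bc Bx) }) , (λ m′ → first m′ Bx) ] (∈-step⁻ m)

    toPath : ∀ {a b} (W : Walk G A a b) → IsPath W → Path G
    toPath W P = record { len = length W ; vtx = vertexAt W ; inj = isPath⇒injective W P ; edges = vertexAt-edge W }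

    interior-≢-ends : ∀ {a b} (W : Walk G A a b) (P : IsPath W) (i : Fin (suc (length W))) →
                      Path.Interior (toPath W P) i → vertexAt W i ≢ a × vertexAt W i ≢ b
    interior-≢-ends W P i (0<i , i<len) =
      (λ eq → ℕ.<⇒≢ 0<i (sym (cong toℕ (inj i fz (trans eq (sym (vertexAt-first W))))))) ,
      (λ eq → ℕ.<⇒≢ i<len (trans (cong toℕ (inj i _ (trans eq (sym (vertexAt-last W))))) (Fin.toℕ-fromℕ _)))
      where inj = isPath⇒injective W P

    record Tripod (a b c : V G) : Set where
      field
        centre : V G
        leg₁ : Walk G A a centre
        leg₂ : Walk G A centre b
        leg₃ : Walk G A c centre
        leg₁-isPath : IsPath leg₁
        leg₂-isPath : IsPath leg₂
        leg₃-isPath : IsPath leg₃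
        leg₁∩leg₂ : ∀ {x} → x ∈ʷ leg₁ → x ∈ʷ leg₂ → x ≡ centre
        leg₁∩leg₃ : ∀ {x} → x ∈ʷ leg₁ → x ∈ʷ leg₃ → x ≡ centre
        leg₂∩leg₃ : ∀ {x} → x ∈ʷ leg₂ → x ∈ʷ leg₃ → x ≡ centre

    tripod : ∀ {a b c} → Walk G A a b → Walk G A c a → Tripod a b c
    tripod Wab Wca with walk⇒path Wab
    ... | P , P-isPath , _ with prefixToFirst (_∈ʷ P) (_∈ʷ? P) Wca (source∈ʷ P)
    ... | t , t∈P , Q₀ , Q₀∩P with walk⇒path Q₀ | splitAt P P-isPath t∈P
    ... | Q , Q-isPath , Q⊆Q₀ | W₁ , W₂ , W₁-isPath , W₂-isPath , W₁⊆P , W₂⊆P , W₁∩W₂ = record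
      { centre = t ; leg₁ = W₁ ; leg₂ = W₂ ; leg₃ = Q
      ; leg₁-isPath = W₁-isPath ; leg₂-isPath = W₂-isPath ; leg₃-isPath = Q-isPath
      ; leg₁∩leg₂ = W₁∩W₂
      ; leg₁∩leg₃ = λ m₁ m₃ → Q₀∩P (Q⊆Q₀ m₃) (W₁⊆P m₁)
      ; leg₂∩leg₃ = λ m₂ m₃ → Q₀∩P (Q⊆Q₀ m₃) (W₂⊆P m₂)
      }

  weaken : ∀ {A B : V G → Set} → (∀ {x} → A x → B x) → ∀ {a b} → Walk G A a b → Walk G B a b
  weaken f (here ax) = here (f ax)
  weaken f (step ax e W) = step (f ax) e (weaken f W)

  module _ {A B : V G → Set} (f : ∀ {x} → A x → B x) where

    ∈-weaken⁻ : ∀ {a b x} (W : Walk G A a b) → x ∈ʷ weaken f W → x ∈ʷ W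
    ∈-weaken⁻ (here _) (fz , refl) = fz , refl
    ∈-weaken⁻ (step _ _ W) (fz , refl) = fz , refl
    ∈-weaken⁻ (step _ _ W) (fs i , p) = ∈-step⁺ (∈-weaken⁻ W (i , p))

    weaken-isPath : ∀ {a b} (W : Walk G A a b) → IsPath W → IsPath (weaken f W)
    weaken-isPath (here _) _ = tt
    weaken-isPath (step _ _ W) (a∉W , P) = a∉W ∘ ∈-weaken⁻ W , weaken-isPath W P

module Separation (G : Graph) where
  open Walks G
  open Graph G using (n)

  module Components (A : V G → Set) (A? : ∀ x → Dec (A x)) where

    WalkOfLength≤ : ℕ → V G → V G → Set
    WalkOfLength≤ zero a b = A a × a ≡ b
    WalkOfLength≤ (suc k) a b = (A a × a ≡ b) ⊎ (A a × ∃[ w ] (E G a w × WalkOfLength≤ k w b))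

    walkOfLength≤? : ∀ k a b → Dec (WalkOfLength≤ k a b)
    walkOfLength≤? zero a b = A? a ×-dec (a Fin.≟ b)
    walkOfLength≤? (suc k) a b =
      (A? a ×-dec (a Fin.≟ b)) ⊎-dec (A? a ×-dec Fin.any? (λ w → E? a w ×-dec walkOfLength≤? k w b))

    fromWalkOfLength≤ : ∀ k {a b} → WalkOfLength≤ k a b → Walk G A a b
    fromWalkOfLength≤ zero (Aa , refl) = here Aa
    fromWalkOfLength≤ (suc k) (inj₁ (Aa , refl)) = here Aa
    fromWalkOfLength≤ (suc k) (inj₂ (Aa , w , e , W)) = step Aa e (fromWalkOfLength≤ k W)

    toWalkOfLength≤ : ∀ {k a b} (W : Walk G A a b) → length W ℕ.≤ k → WalkOfLength≤ k a b
    toWalkOfLength≤ {zero} (here Aa) _ = Aa , refl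
    toWalkOfLength≤ {suc k} (here Aa) _ = inj₁ (Aa , refl)
    toWalkOfLength≤ {suc k} (step Aa e W) (s≤s len≤k) = inj₂ (Aa , _ , e , toWalkOfLength≤ W len≤k)

    walk? : ∀ a b → Dec (Walk G A a b)
    walk? a b with walkOfLength≤? n a b
    ... | yes W = yes (fromWalkOfLength≤ n W)
    ... | no ¬W = no λ W → let (W′ , P′ , _) = walk⇒path W in
                            ¬W (toWalkOfLength≤ W′ (ℕ.<⇒≤ (path-length< W′ P′)))

    -- A component of G[A] is represented by its vertex of least index.
    Leader : V G → Set
    Leader v = A v × (∀ w → Walk G A v w → toℕ v ℕ.≤ toℕ w)

    leader? : ∀ v → Dec (Leader v)
    leader? v = A? v ×-dec Fin.all? (λ w → walk? v w →-dec (toℕ v ℕ.≤? toℕ w))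

    reachesLeader : ∀ m {v w} → toℕ w ℕ.< m → Walk G A v w → ∃[ ℓ ] (Leader ℓ × Walk G A v ℓ)
    reachesLeader (suc m) {v} {w} w<m W with leader? w
    ... | yes Lw = w , Lw , W
    ... | no ¬Lw with Fin.¬∀⟶∃¬ n _ (λ w′ → walk? w w′ →-dec (toℕ w ℕ.≤? toℕ w′)) (λ f → ¬Lw (target∈ W , f))
    ...   | w′ , ¬w≤w′ with walk? w w′
    ...     | no ¬W′ = ⊥-elim (¬w≤w′ (⊥-elim ∘ ¬W′))
    ...     | yes W′ = reachesLeader m (ℕ.≤-trans (ℕ.≰⇒> (¬w≤w′ ∘ λ le _ → le)) (ℕ.≤-pred w<m)) (W ++ʷ W′)

    leaders : List (V G)
    leaders = filter leader? (allFin n)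

    lookup-injective : ∀ (xs : List (V G)) → Unique xs → ∀ i j → lookup xs i ≡ lookup xs j → i ≡ j
    lookup-injective (x ∷ xs) (_ ∷ _) fz fz _ = refl
    lookup-injective (x ∷ xs) (x∉ ∷ _) fz (fs j) p = ⊥-elim (All.lookup x∉ (∈-lookup j) p)
    lookup-injective (x ∷ xs) (x∉ ∷ _) (fs i) fz p = ⊥-elim (All.lookup x∉ (∈-lookup i) (sym p))
    lookup-injective (x ∷ xs) (_ ∷ u) (fs i) (fs j) p = cong fs (lookup-injective xs u i j p)

    leaderAt : ∀ i → Leader (lookup leaders i)
    leaderAt i = proj₂ (∈-filter⁻ leader? {xs = allFin n} (∈-lookup i))

    components : ∃[ k ] NComp G A k
    components = List.length leaders , lookup leaders , (λ i → proj₁ (leaderAt i)) , separated , covered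
      where
      separated : ∀ i j → i ≢ j → ¬ Walk G A (lookup leaders i) (lookup leaders j)
      separated i j i≢j W = i≢j (lookup-injective leaders (filter⁺ leader? (allFin⁺ n)) i j
        (Fin.toℕ-injective (ℕ.≤-antisym (proj₂ (leaderAt i) _ W) (proj₂ (leaderAt j) _ (reverse W)))))
      covered : ∀ v → A v → ∃[ i ] Walk G A v (lookup leaders i)
      covered v Av with reachesLeader (suc (toℕ v)) ℕ.≤-refl (here Av)
      ... | ℓ , Lℓ , W with ∈-filter⁺ leader? {xs = allFin n} (∈-allFin ℓ) Lℓ
      ...   | ℓ∈ = Any.index ℓ∈ , subst (Walk G A v) (lookup-index ℓ∈) W

  separator⇒cutset : (S : V G → Set) → (∀ x → Dec (S x)) → ∃ S → (∀ {w} → S w → ∃[ y ] (¬ S y × E G w y)) →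
                     ∀ {x y} → ¬ S x → ¬ S y → Walk G (λ _ → ⊤) x y → ¬ Walk G (λ v → ¬ S v) x y → Cutset G S
  -- Sending each component of G − S to the component of G containing it is onto, since every
  -- component of G meets G − S, but it identifies the components of x and y.
  separator⇒cutset S S? S≢∅ escape {x} {y} ¬Sx ¬Sy Wxy ¬Wxy
    with Components.components (λ _ → ⊤) (λ _ → yes tt) | Components.components (λ v → ¬ S v) (¬? ∘ S?)
  ... | k , r , r∈ , r-separated , r-covers | k′ , r′ , r′∈ , r′-separated , r′-covers =
    S≢∅ , k , k′ , (r , r∈ , r-separated , r-covers) , (r′ , r′∈ , r′-separated , r′-covers) ,
    surjective-with-collision⇒< f f-surjective (comp′ ¬Sx) (comp′ ¬Sy) x≁y fx≡fy
    where
    comp′ : ∀ {v} → ¬ S v → Fin k′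
    comp′ ¬Sv = proj₁ (r′-covers _ ¬Sv)
    toComp′ : ∀ {v} (¬Sv : ¬ S v) → Walk G (λ v → ¬ S v) v (r′ (comp′ ¬Sv))
    toComp′ ¬Sv = proj₂ (r′-covers _ ¬Sv)
    f : Fin k′ → Fin k
    f i = proj₁ (r-covers (r′ i) tt)
    toComp : ∀ i → Walk G (λ _ → ⊤) (r′ i) (r (f i))
    toComp i = proj₂ (r-covers (r′ i) tt)
    forget : ∀ {a b} → Walk G (λ v → ¬ S v) a b → Walk G (λ _ → ⊤) a b
    forget = weaken (λ _ → tt)
    same-component : ∀ j j′ → Walk G (λ _ → ⊤) (r j) (r j′) → j ≡ j′
    same-component j j′ W with j Fin.≟ j′
    ... | yes j≡j′ = j≡j′
    ... | no j≢j′ = ⊥-elim (r-separated j j′ j≢j′ W)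
    outside : ∀ j → ∃[ y ] (¬ S y × Walk G (λ _ → ⊤) (r j) y)
    outside j with S? (r j)
    ... | no ¬Srj = r j , ¬Srj , here tt
    ... | yes Srj = let (y , ¬Sy , e) = escape Srj in y , ¬Sy , step tt e (here tt)
    f-surjective : ∀ j → ∃[ i ] f i ≡ j
    f-surjective j = let (y , ¬Sy , W) = outside j in
      comp′ ¬Sy , sym (same-component j _ (W ++ʷ (forget (toComp′ ¬Sy) ++ʷ toComp (comp′ ¬Sy))))
    x≁y : comp′ ¬Sx ≢ comp′ ¬Sy
    x≁y eq = ¬Wxy (toComp′ ¬Sx ++ʷ subst (λ i → Walk G _ (r′ i) y) (sym eq) (reverse (toComp′ ¬Sy)))
    fx≡fy : f (comp′ ¬Sx) ≡ f (comp′ ¬Sy)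
    fx≡fy = same-component _ _ (reverse (toComp _) ++ʷ (reverse (forget (toComp′ ¬Sx)) ++ʷ
                                 (Wxy ++ʷ (forget (toComp′ ¬Sy) ++ʷ toComp _))))

  edge⇒clique : ∀ {u v} → E G u v → Clique G (λ x → x ≡ u ⊎ x ≡ v)
  edge⇒clique uv _ _ (inj₁ refl) (inj₁ refl) u≢u = ⊥-elim (u≢u refl)
  edge⇒clique uv _ _ (inj₁ refl) (inj₂ refl) _ = uv
  edge⇒clique uv _ _ (inj₂ refl) (inj₁ refl) _ = E-sym uv
  edge⇒clique uv _ _ (inj₂ refl) (inj₂ refl) v≢v = ⊥-elim (v≢v refl)

module Attachments (G : Graph) (s : V G) (K : V G → Set)
                   (K-component : IsComponent G (λ x → (x ≢ s) × ¬ E G s x) K) where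
  open Walks G
  open Separation G

  -- Attached is the paper's N, and Region is V(K) ∪ N ∪ {s}.
  Attached : V G → Set
  Attached x = E G s x × ∃[ w ] (K w × E G x w)

  Region : V G → Set
  Region x = K x ⊎ Attached x ⊎ x ≡ s

  K⇒¬N[s] : ∀ {x} → K x → (x ≢ s) × ¬ E G s x
  K⇒¬N[s] = proj₁ (proj₂ K-component) _

  ¬K-s : ¬ K s
  ¬K-s Ks = proj₁ (K⇒¬N[s] Ks) refl

  ¬K-N : ∀ {x} → E G s x → ¬ K x
  ¬K-N sx Kx = proj₂ (K⇒¬N[s] Kx) sx

  K-closed : ∀ {x y} → K x → Walk G (λ x → (x ≢ s) × ¬ E G s x) x y → K y
  K-closed = proj₂ (proj₂ (proj₂ K-component)) _ _

  K-connected : ∀ {a b} → K a → K b → Walk G K a b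
  K-connected {a} {b} Ka Kb = inK Ka (proj₁ (proj₂ (proj₂ K-component)) a b Ka Kb)
    where
    inK : ∀ {x y} → K x → Walk G (λ x → (x ≢ s) × ¬ E G s x) x y → Walk G K x y
    inK Kx (here _) = here Kx
    inK Kx (step x∉ e W) = step Kx e (inK (K-closed Kx (step x∉ e (here (source∈ W)))) W)

  K-neighbour : ∀ {x y} → K x → E G x y → K y ⊎ E G s y
  K-neighbour {x} {y} Kx xy with y Fin.≟ s | E? s y
  ... | yes refl | _ = ⊥-elim (¬K-N (E-sym xy) Kx)
  ... | no _ | yes sy = inj₂ sy
  ... | no y≢s | no ¬sy = inj₁ (K-closed Kx (step (K⇒¬N[s] Kx) xy (here (y≢s , ¬sy))))

  walk-avoiding-attachments-stays-in-K : (S : V G → Set) → (∀ {y} → ¬ S y → ¬ Attached y) →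
                                         ∀ {a b} → Walk G (λ y → ¬ S y) a b → K a → K b
  walk-avoiding-attachments-stays-in-K S attachments⊆S (here _) Ka = Ka
  walk-avoiding-attachments-stays-in-K S attachments⊆S {a} (step _ e W) Ka with K-neighbour Ka e
  ... | inj₁ Kw = walk-avoiding-attachments-stays-in-K S attachments⊆S W Kw
  ... | inj₂ sw = ⊥-elim (attachments⊆S (source∈ W) (sw , a , Ka , E-sym e))

  two-attachments⇒cutset : ∀ {u v} → Attached u → Attached v → ¬ (∃[ z ] (Attached z × z ≢ u × z ≢ v)) →
                           Cutset G (λ x → x ≡ u ⊎ x ≡ v)
  two-attachments⇒cutset {u} {v} (su , w , Kw , uw) (sv , _) no-third =
    separator⇒cutset S S? (u , inj₁ refl) escape ¬Ss ¬Sw (step tt su (step tt uw (here tt))) separated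
    where
    S : V G → Set
    S x = x ≡ u ⊎ x ≡ v
    S? : ∀ x → Dec (S x)
    S? x = (x Fin.≟ u) ⊎-dec (x Fin.≟ v)
    ¬Ss : ¬ S s
    ¬Ss = [ E⇒≢ su , E⇒≢ sv ]
    ¬Sw : ¬ S w
    ¬Sw = [ (λ { refl → ¬K-N su Kw }) , (λ { refl → ¬K-N sv Kw }) ]
    escape : ∀ {x} → S x → ∃[ y ] (¬ S y × E G x y)
    escape (inj₁ refl) = s , ¬Ss , E-sym su
    escape (inj₂ refl) = s , ¬Ss , E-sym sv
    separated : ¬ Walk G (λ y → ¬ S y) s w
    separated W = ¬K-s (walk-avoiding-attachments-stays-in-K S
      (λ ¬Sy Ay → no-third (_ , Ay , ¬Sy ∘ inj₁ , ¬Sy ∘ inj₂)) (reverse W) Kw)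

  module Subdivision {u v z a b c} (su : E G s u) (sv : E G s v) (sz : E G s z) (uv : E G u v)
                     (ua : E G u a) (vb : E G v b) (zc : E G z c) (z≢u : z ≢ u) (z≢v : z ≢ v)
                     (T : Tripod {K} a b c) where
    open Tripod T renaming (centre to t)

    Kt : K t
    Kt = target∈ leg₁

    s≢t : s ≢ t
    s≢t refl = ¬K-s Kt

    u≢t : u ≢ t
    u≢t refl = ¬K-N su Kt

    t≢v : t ≢ v
    t≢v refl = ¬K-N sv Kt

    z≢t : z ≢ t
    z≢t refl = ¬K-N sz Kt

    Rs : Region s
    Rs = inj₂ (inj₂ refl)
    Ru : Region u
    Ru = inj₂ (inj₁ (su , a , source∈ leg₁ , ua))
    Rv : Region v
    Rv = inj₂ (inj₁ (sv , b , target∈ leg₂ , vb))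
    Rz : Region z
    Rz = inj₂ (inj₁ (sz , c , source∈ leg₃ , zc))

    inR : ∀ {x y} → Walk G K x y → Walk G Region x y
    inR = weaken inj₁

    ∈-inR⁻ : ∀ {x y w} (W : Walk G K x y) → w ∈ʷ inR W → w ∈ʷ W
    ∈-inR⁻ = ∈-weaken⁻ inj₁

    ∉-inR : ∀ {x y w} (W : Walk G K x y) → ¬ K w → ¬ w ∈ʷ inR W
    ∉-inR W ¬Kw = ¬Kw ∘ ∈ʷ⇒∈ W ∘ ∈-inR⁻ W

    branch : Fin 4 → V G
    branch fz = s
    branch (fs fz) = u
    branch (fs (fs fz)) = t
    branch (fs (fs (fs fz))) = v

    branch-injective : ∀ i j → branch i ≡ branch j → i ≡ j
    branch-injective fz fz _ = refl
    branch-injective fz (fs fz) eq = ⊥-elim (E⇒≢ su eq)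
    branch-injective fz (fs (fs fz)) eq = ⊥-elim (s≢t eq)
    branch-injective fz (fs (fs (fs fz))) eq = ⊥-elim (E⇒≢ sv eq)
    branch-injective (fs fz) fz eq = ⊥-elim (E⇒≢ su (sym eq))
    branch-injective (fs fz) (fs fz) _ = refl
    branch-injective (fs fz) (fs (fs fz)) eq = ⊥-elim (u≢t eq)
    branch-injective (fs fz) (fs (fs (fs fz))) eq = ⊥-elim (E⇒≢ uv eq)
    branch-injective (fs (fs fz)) fz eq = ⊥-elim (s≢t (sym eq))
    branch-injective (fs (fs fz)) (fs fz) eq = ⊥-elim (u≢t (sym eq))
    branch-injective (fs (fs fz)) (fs (fs fz)) _ = refl
    branch-injective (fs (fs fz)) (fs (fs (fs fz))) eq = ⊥-elim (t≢v eq)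
    branch-injective (fs (fs (fs fz))) fz eq = ⊥-elim (E⇒≢ sv (sym eq))
    branch-injective (fs (fs (fs fz))) (fs fz) eq = ⊥-elim (E⇒≢ uv (sym eq))
    branch-injective (fs (fs (fs fz))) (fs (fs fz)) eq = ⊥-elim (t≢v (sym eq))
    branch-injective (fs (fs (fs fz))) (fs (fs (fs fz))) _ = refl

    route : (p : K4Pair) → Walk G Region (branch (pfst p)) (branch (psnd p))
    route p01 = step Rs su (here Ru)
    route p02 = step Rs sz (step Rz zc (inR leg₃))
    route p03 = step Rs sv (here Rv)
    route p12 = step Ru ua (inR leg₁)
    route p13 = step Ru uv (here Rv)
    route p23 = snoc (inR leg₂) Rv (E-sym vb)

    route-isPath : ∀ p → IsPath (route p)
    route-isPath p01 = (λ { (_ , u≡s) → E⇒≢ su (sym u≡s) }) , tt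
    route-isPath p02 = [ E⇒≢ sz , ∉-inR leg₃ ¬K-s ] ∘ ∈-step⁻ , ∉-inR leg₃ (¬K-N sz) , weaken-isPath inj₁ leg₃ leg₃-isPath
    route-isPath p03 = (λ { (_ , v≡s) → E⇒≢ sv (sym v≡s) }) , tt
    route-isPath p12 = ∉-inR leg₁ (¬K-N su) , weaken-isPath inj₁ leg₁ leg₁-isPath
    route-isPath p13 = (λ { (_ , v≡u) → E⇒≢ uv (sym v≡u) }) , tt
    route-isPath p23 = snoc-isPath (inR leg₂) (weaken-isPath inj₁ leg₂ leg₂-isPath) (∉-inR leg₂ (¬K-N sv))

    Inner : K4Pair → V G → Set
    Inner p02 x = x ≡ z ⊎ (x ∈ʷ leg₃ × x ≢ t)
    Inner p12 x = x ∈ʷ leg₁ × x ≢ t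
    Inner p23 x = x ∈ʷ leg₂ × x ≢ t
    Inner _ _ = ⊥

    K-¬branch : ∀ {x} → K x → x ≢ t → ∀ i → x ≢ branch i
    K-¬branch Kx _ fz refl = ¬K-s Kx
    K-¬branch Kx _ (fs fz) refl = ¬K-N su Kx
    K-¬branch Kx x≢t (fs (fs fz)) = x≢t
    K-¬branch Kx _ (fs (fs (fs fz))) refl = ¬K-N sv Kx

    z-¬branch : ∀ i → z ≢ branch i
    z-¬branch fz = E⇒≢ sz ∘ sym
    z-¬branch (fs fz) = z≢u
    z-¬branch (fs (fs fz)) = z≢t
    z-¬branch (fs (fs (fs fz))) = z≢v

    inner-¬branch : ∀ p {x} → Inner p x → ∀ i → x ≢ branch i
    inner-¬branch p02 (inj₁ refl) = z-¬branch
    inner-¬branch p02 (inj₂ (m , x≢t)) = K-¬branch (∈ʷ⇒∈ leg₃ m) x≢t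
    inner-¬branch p12 (m , x≢t) = K-¬branch (∈ʷ⇒∈ leg₁ m) x≢t
    inner-¬branch p23 (m , x≢t) = K-¬branch (∈ʷ⇒∈ leg₂ m) x≢t

    centreOr : ∀ {x} {P : Set} → (x ≢ t → P) → x ≡ t ⊎ P
    centreOr {x} f with x Fin.≟ t
    ... | yes x≡t = inj₁ x≡t
    ... | no x≢t = inj₂ (f x≢t)

    End : K4Pair → V G → Set
    End q x = x ≡ branch (pfst q) ⊎ x ≡ branch (psnd q)

    on-route : ∀ q {x} → x ∈ʷ route q → End q x ⊎ Inner q x
    on-route p01 (fz , refl) = inj₁ (inj₁ refl)
    on-route p01 (fs fz , refl) = inj₁ (inj₂ refl)
    on-route p02 (fz , refl) = inj₁ (inj₁ refl)
    on-route p02 (fs fz , refl) = inj₂ (inj₁ refl)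
    on-route p02 (fs (fs i) , p) = map inj₂ inj₂ (centreOr (∈-inR⁻ leg₃ (i , p) ,_))
    on-route p03 (fz , refl) = inj₁ (inj₁ refl)
    on-route p03 (fs fz , refl) = inj₁ (inj₂ refl)
    on-route p12 (fz , refl) = inj₁ (inj₁ refl)
    on-route p12 (fs i , p) = map₁ inj₂ (centreOr (∈-inR⁻ leg₁ (i , p) ,_))
    on-route p13 (fz , refl) = inj₁ (inj₁ refl)
    on-route p13 (fs fz , refl) = inj₁ (inj₂ refl)
    on-route p23 m with ∈-snoc⁻ (inR leg₂) m
    ... | inj₁ m′ = map₁ inj₁ (centreOr (∈-inR⁻ leg₂ m′ ,_))
    ... | inj₂ refl = inj₁ (inj₂ refl)

    path : K4Pair → Path G
    path p = toPath (route p) (route-isPath p)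

    interior⇒inner : ∀ p i → Path.Interior (path p) i → Inner p (vertexAt (route p) i)
    interior⇒inner p i int with on-route p (i , refl) | interior-≢-ends (route p) (route-isPath p) i int
    ... | inj₂ inner | _ = inner
    ... | inj₁ (inj₁ x≡start) | x≢start , _ = ⊥-elim (x≢start x≡start)
    ... | inj₁ (inj₂ x≡end) | _ , x≢end = ⊥-elim (x≢end x≡end)

    inner₀₂∩inner₁₂ : ∀ {x} → Inner p02 x → Inner p12 x → ⊥
    inner₀₂∩inner₁₂ (inj₁ refl) (m₁ , _) = ¬K-N sz (∈ʷ⇒∈ leg₁ m₁)
    inner₀₂∩inner₁₂ (inj₂ (m₃ , x≢t)) (m₁ , _) = x≢t (leg₁∩leg₃ m₁ m₃)

    inner₀₂∩inner₂₃ : ∀ {x} → Inner p02 x → Inner p23 x → ⊥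
    inner₀₂∩inner₂₃ (inj₁ refl) (m₂ , _) = ¬K-N sz (∈ʷ⇒∈ leg₂ m₂)
    inner₀₂∩inner₂₃ (inj₂ (m₃ , x≢t)) (m₂ , _) = x≢t (leg₂∩leg₃ m₂ m₃)

    inner₁₂∩inner₂₃ : ∀ {x} → Inner p12 x → Inner p23 x → ⊥
    inner₁₂∩inner₂₃ (m₁ , x≢t) (m₂ , _) = x≢t (leg₁∩leg₂ m₁ m₂)

    inner-unique : ∀ p q {x} → Inner p x → Inner q x → p ≡ q
    inner-unique p02 p02 _ _ = refl
    inner-unique p12 p12 _ _ = refl
    inner-unique p23 p23 _ _ = refl
    inner-unique p02 p12 i j = ⊥-elim (inner₀₂∩inner₁₂ i j)
    inner-unique p12 p02 i j = ⊥-elim (inner₀₂∩inner₁₂ j i)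
    inner-unique p02 p23 i j = ⊥-elim (inner₀₂∩inner₂₃ i j)
    inner-unique p23 p02 i j = ⊥-elim (inner₀₂∩inner₂₃ j i)
    inner-unique p12 p23 i j = ⊥-elim (inner₁₂∩inner₂₃ i j)
    inner-unique p23 p12 i j = ⊥-elim (inner₁₂∩inner₂₃ j i)
    inner-unique p01 _ () _
    inner-unique p03 _ () _
    inner-unique p13 _ () _
    inner-unique p02 p01 _ ()
    inner-unique p02 p03 _ ()
    inner-unique p02 p13 _ ()
    inner-unique p12 p01 _ ()
    inner-unique p12 p03 _ ()
    inner-unique p12 p13 _ ()
    inner-unique p23 p01 _ ()
    inner-unique p23 p03 _ ()
    inner-unique p23 p13 _ ()

    end⇒branch : ∀ q {x} → End q x → ∃[ i ] x ≡ branch i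
    end⇒branch q = [ (pfst q ,_) , (psnd q ,_) ]

    subdivision : K4Sub G
    subdivision = record
      { br = branch
      ; br-inj = branch-injective
      ; path = path
      ; starts = λ p → vertexAt-first (route p)
      ; ends = λ p → vertexAt-last (route p)
      ; int-nobr = λ p i int → inner-¬branch p (interior⇒inner p i int)
      ; int-disj = λ p q p≢q i i′ int eq → disjoint p q p≢q (subst (Inner p) eq (interior⇒inner p i int)) (on-route q (i′ , refl))
      }
      where
      disjoint : ∀ p q → p ≢ q → ∀ {x} → Inner p x → End q x ⊎ Inner q x → ⊥
      disjoint p q _ inner (inj₁ end) = let (j , x≡j) = end⇒branch q end in inner-¬branch p inner j x≡j
      disjoint p q p≢q inner (inj₂ inner′) = p≢q (inner-unique p q inner inner′)

    subdivision⊆region : ∀ x → K4Sub.Vert subdivision x → Region x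
    subdivision⊆region x (p , m) = ∈ʷ⇒∈ (route p) m

  three-attachments⇒K4 : ∀ {u v z} → Attached u → Attached v → Attached z → z ≢ u → z ≢ v → E G u v →
                         Σ (K4Sub G) λ S → ∀ x → K4Sub.Vert S x → Region x
  three-attachments⇒K4 (su , a , Ka , ua) (sv , b , Kb , vb) (sz , c , Kc , zc) z≢u z≢v uv =
    subdivision , subdivision⊆region
    where open Subdivision su sv sz uv ua vb zc z≢u z≢v (tripod (K-connected Ka Kb) (K-connected Kc Ka))

lemma4p2 : (G : Graph) →
           ¬ HasISK4 G →
           ¬ ContainsInduced G 4 diamond →
           ¬ ContainsInduced G 5 bowtie →
           ¬ HasPrism G →
           ¬ ContainsInduced G 6 K33 →
           NoCliqueCutset G →
           (s : V G) → ProperWheelCenter G s →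
           (K : V G → Set) →
           IsComponent G (λ v → (v ≢ s) × ¬ E G s v) K →
           SeriesParallel G (λ v → K v ⊎ (E G s v × ∃[ w ] (K w × E G v w)) ⊎ v ≡ s) →
           ∀ u v → E G s u → (∃[ w ] (K w × E G u w)) →
                   E G s v → (∃[ w ] (K w × E G v w)) →
                   ¬ E G u v
lemma4p2 G _ _ _ _ _ no-clique-cutset s _ K K-component series-parallel u v su uK sv vK uv =
  no-clique-cutset (λ x → x ≡ u ⊎ x ≡ v) (edge⇒clique uv) (two-attachments⇒cutset (su , uK) (sv , vK) third⇒K4)
  where
  open Separation G
  open Attachments G s K K-component
  third⇒K4 : ¬ (∃[ z ] (Attached z × z ≢ u × z ≢ v))
  third⇒K4 (z , Az , z≢u , z≢v) = series-parallel (three-attachments⇒K4 (su , uK) (sv , vK) Az z≢u z≢v uv)
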